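{- Let $G$ be a finite bipartite graph with bipartition $(X,Y)$, let $k$ be an odd positive integer, and let $a_1a_2\dots a_k$ and $b_1b_2\dots b_k$ be congruent walks with $a_1,b_1\in X$ (so $a_i,b_i\in X$ for odd $i$, in $Y$ for even $i$). Let $C_X=\{a_i,b_i: i \text{ odd}\}$ and $C_Y=\{a_i,b_i : i\text{ even}\}$. Suppose $c_1\in X$, $c_2\in Y$ satisfy one of: (1) $c_1c_2\in E(G)$, $c_1$ is adjacent to no vertex of $C_Y$, and $c_2$ is adjacent to no vertex of $C_X$; or (2) $c_1c_2\notin E(G)$, $c_1$ is adjacent to every vertex of $C_Y$, and $c_2$ is adjacent to every vertex of $C_X$. Then $(a_1,c_1)\,\Gamma\,(a_k,c_1)$ and $(c_1,b_1)\,\Gamma\,(c_1,b_k)$.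
   Context: Two edges $xy,x'y'$ ($x,x'\in X$, $y,y'\in Y$) are independent if $x\ne x'$, $y\ne y'$, $xy'\notin E(G)$ and $x'y\notin E(G)$. Two walks $a_1\dots a_k$, $b_1\dots b_k$ (same number of vertices) with $a_1,b_1$ in the same part are congruent if for each $i=1,\dots,k-1$ the edges $a_ia_{i+1}$ and $b_ib_{i+1}$ are independent. An $(a,f)$-walk is a walk from $a$ to $f$. For pairs $(a,b)$, $(f,g)$ of vertices with $a,b$ in the same part, $(a,b)\,\Gamma\,(f,g)$ means that there exist congruent $(a,f)$- and $(b,g)$-walks. -}

module Defs where

open import Data.Nat using (ℕ; zero; suc; _+_; _*_)
open import Data.Fin using (Fin; zero; suc; toℕ; inject₁; fromℕ)
open import Data.Bool using (Bool; T)
open import Data.Sum using (_⊎_; inj₁; inj₂)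
open import Data.Product using (Σ; ∃; _×_; _,_)
open import Data.Unit using (⊤)
open import Data.Empty using (⊥)
open import Relation.Nullary using (¬_)
open import Relation.Binary.PropositionalEquality using (_≡_; _≢_)

Even : ℕ → Set
Even n = ∃ λ m → n ≡ 2 * m

Odd : ℕ → Set
Odd n = ∃ λ m → n ≡ suc (2 * m)

-- A finite bipartite graph with bipartition (X , Y), X = Fin p, Y = Fin q,
-- given by its (decidable) adjacency E x y between x ∈ X and y ∈ Y.
record BipGraph : Set where
  field
    p : ℕ
    q : ℕ
    E : Fin p → Fin q → Bool

module _ (G : BipGraph) where
  open BipGraph G

  V : Set
  V = Fin p ⊎ Fin q

  InX : V → Set
  InX (inj₁ _) = ⊤
  InX (inj₂ _) = ⊥

  InY : V → Set
  InY (inj₁ _) = ⊥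
  InY (inj₂ _) = ⊤

  SamePart : V → V → Set
  SamePart u v = (InX u × InX v) ⊎ (InY u × InY v)

  Adj : V → V → Set
  Adj (inj₁ x) (inj₂ y) = T (E x y)
  Adj (inj₂ y) (inj₁ x) = T (E x y)
  Adj (inj₁ _) (inj₁ _) = ⊥
  Adj (inj₂ _) (inj₂ _) = ⊥

  Independent : V → V → V → V → Set
  Independent u v u' v' =
    SamePart u u' × Adj u v × Adj u' v' ×
    u ≢ u' × v ≢ v' × ¬ Adj u v' × ¬ Adj u' v

  -- A walk with k = suc n vertices a₁ … a_k is a map a : Fin (suc n) → V
  -- (0-indexed: a zero = a₁) with consecutive vertices adjacent.
  IsWalk : {n : ℕ} → (Fin (suc n) → V) → Set
  IsWalk {n} a = (i : Fin n) → Adj (a (inject₁ i)) (a (suc i))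

  Congruent : {n : ℕ} → (Fin (suc n) → V) → (Fin (suc n) → V) → Set
  Congruent {n} a b =
    IsWalk a × IsWalk b × SamePart (a zero) (b zero) ×
    ((i : Fin n) → Independent (a (inject₁ i)) (a (suc i)) (b (inject₁ i)) (b (suc i)))

  Γ : V → V → V → V → Set
  Γ a b f g = SamePart a b × ∃ λ n → Σ (Fin (suc n) → V) λ w → Σ (Fin (suc n) → V) λ z →
    Congruent w z × w zero ≡ a × w (fromℕ n) ≡ f × z zero ≡ b × z (fromℕ n) ≡ g

  -- C_X = {aᵢ, bᵢ : i odd} (1-indexed), i.e. 0-indexed positions with even index.
  InCX : {n : ℕ} → (Fin (suc n) → V) → (Fin (suc n) → V) → V → Set
  InCX {n} a b v = ∃ λ (i : Fin (suc n)) → Even (toℕ i) × (v ≡ a i ⊎ v ≡ b i)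

  -- C_Y = {aᵢ, bᵢ : i even} (1-indexed), i.e. 0-indexed positions with odd index.
  InCY : {n : ℕ} → (Fin (suc n) → V) → (Fin (suc n) → V) → V → Set
  InCY {n} a b v = ∃ λ (i : Fin (suc n)) → Odd (toℕ i) × (v ≡ a i ⊎ v ≡ b i)

module Submission where

-- Call c₂ the partner of every X-vertex and c₁ the partner of
-- every Y-vertex.  A walk starting in X alternates between the parts, so X- and
-- Y-vertices sit at even and odd positions; hence both hypotheses (1) and (2)
-- just say that every vertex of a and b is non-adjacent (resp. adjacent) to its
-- partner.  Since k is odd, such walks also end in X.
--
-- (1) Pair a with its shadow c₁c₂c₁…c₁.  Each step aᵢaᵢ₊₁ is independent from
--     the edge c₁c₂, because both cross pairs are partner pairs, hence non-edges.
-- (2) Pair a₁c₂a₃c₂…a_k (Y-vertices of a replaced by c₂) with c₁b₂c₁b₄…c₁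
--     (X-vertices of b replaced by c₁).  Every step uses partner edges, and its
--     cross pairs are c₁c₂ and a cross pair of the congruent walks a, b.
-- In both cases independence follows from one observation: two edges whose
-- cross pairs are non-edges are independent.  The second claim of the theorem
-- is the first one for the congruent walks (b, a), read through the symmetry
-- of Γ.

open import Defs
open import Data.Nat using (ℕ; zero; suc)
open import Data.Nat.Properties using (suc-injective; *-suc)
open import Data.Fin using (Fin; zero; suc; toℕ; inject₁; fromℕ)
open import Data.Fin.Properties using (toℕ-fromℕ)
open import Data.Bool using (T)
open import Data.Sum using (_⊎_; inj₁; inj₂)
open import Data.Product using (_×_; _,_; proj₁; proj₂)
open import Data.Unit using (tt)
open import Data.Empty using (⊥; ⊥-elim)
open import Function using (_∘_)
open import Relation.Nullary using (¬_)
open import Relation.Binary.PropositionalEquality using (_≡_; refl; sym; trans; cong; subst; subst₂)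

odd-suc : ∀ {m} → Even m → Odd (suc m)
odd-suc (k , m≡2k) = k , cong suc m≡2k

even-suc : ∀ {m} → Odd m → Even (suc m)
even-suc (k , m≡1+2k) = suc k , trans (cong suc m≡1+2k) (sym (*-suc 2 k))

even-pred : ∀ {m} → Odd (suc m) → Even m
even-pred (k , eq) = k , suc-injective eq

odd-pred : ∀ {m} → Even (suc m) → Odd m
odd-pred (zero , ())
odd-pred (suc k , eq) = k , suc-injective (trans eq (*-suc 2 k))

even-odd-disjoint : ∀ m → Even m → Odd m → ⊥
even-odd-disjoint zero _ (_ , ())
even-odd-disjoint (suc m) even odd = even-odd-disjoint m (even-pred odd) (odd-pred even)

module _ (G : BipGraph) where
  open BipGraph G

  X-Y-disjoint : ∀ {w} → InX G w → InY G w → ⊥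
  X-Y-disjoint {inj₁ _} _ ()

  SamePart-sym : ∀ {u v} → SamePart G u v → SamePart G v u
  SamePart-sym (inj₁ (x , y)) = inj₁ (y , x)
  SamePart-sym (inj₂ (x , y)) = inj₂ (y , x)

  SamePart-X : ∀ {u v} → SamePart G u v → InX G u → InX G v
  SamePart-X (inj₁ (_ , x)) _ = x
  SamePart-X (inj₂ (y , _)) x = ⊥-elim (X-Y-disjoint x y)

  different-parts : ∀ {x y} → ¬ SamePart G (inj₁ x) (inj₂ y)
  different-parts (inj₁ (_ , ()))
  different-parts (inj₂ (() , _))

  Independent-sym : ∀ {u v u' v'} → Independent G u v u' v' → Independent G u' v' u v
  Independent-sym (sp , uv , u'v' , u≢u' , v≢v' , ¬uv' , ¬u'v) =
    SamePart-sym sp , u'v' , uv , u≢u' ∘ sym , v≢v' ∘ sym , ¬u'v , ¬uv'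

  Congruent-sym : ∀ {n} {a b : Fin (suc n) → V G} → Congruent G a b → Congruent G b a
  Congruent-sym (walkA , walkB , sp , steps) =
    walkB , walkA , SamePart-sym sp , Independent-sym ∘ steps

  Γ-sym : ∀ {a b f g} → Γ G a b f g → Γ G b a g f
  Γ-sym (sp , n , w , z , cong-wz , w₀ , wₙ , z₀ , zₙ) =
    SamePart-sym sp , n , z , w , Congruent-sym {a = w} {b = z} cong-wz , z₀ , zₙ , w₀ , wₙ

  -- Two edges uv, u'v' whose cross pairs uv', u'v are non-edges are
  -- independent: identifying u with u' (or v with v') would make a cross pair
  -- an edge.
  independent-if-no-cross : ∀ {u v u' v'} → SamePart G u u' → Adj G u v → Adj G u' v' →
    ¬ Adj G u v' → ¬ Adj G u' v → Independent G u v u' v'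
  independent-if-no-cross sp uv u'v' ¬uv' ¬u'v =
    sp , uv , u'v' , (λ { refl → ¬uv' u'v' }) , (λ { refl → ¬u'v u'v' }) , ¬uv' , ¬u'v

  congruent-from-steps : ∀ {n} (w z : Fin (suc n) → V G) → SamePart G (w zero) (z zero) →
    ((i : Fin n) → Independent G (w (inject₁ i)) (w (suc i)) (z (inject₁ i)) (z (suc i))) →
    Congruent G w z
  congruent-from-steps w z sp steps =
    (proj₁ ∘ proj₂ ∘ steps) , (proj₁ ∘ proj₂ ∘ proj₂ ∘ steps) , sp , steps

  -- The vertex w sits at a position of parity m of a walk starting in X.
  Alternating : V G → ℕ → Set
  Alternating w m = (InX G w × Even m) ⊎ (InY G w × Odd m)

  alternating-step : ∀ {u v m} → Adj G u v → Alternating u m → Alternating v (suc m)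
  alternating-step {inj₁ _} {inj₂ _} _ (inj₁ (_ , even)) = inj₂ (tt , odd-suc even)
  alternating-step {inj₂ _} {inj₁ _} _ (inj₂ (_ , odd)) = inj₁ (tt , even-suc odd)
  alternating-step {inj₁ _} {inj₂ _} _ (inj₂ (() , _))
  alternating-step {inj₂ _} {inj₁ _} _ (inj₁ (() , _))
  alternating-step {inj₁ _} {inj₁ _} ()
  alternating-step {inj₂ _} {inj₂ _} ()

  walk-alternates : ∀ {n} (a : Fin (suc n) → V G) → IsWalk G a → InX G (a zero) →
    ∀ i → Alternating (a i) (toℕ i)
  walk-alternates a walk x₀ zero = inj₁ (x₀ , 0 , refl)
  walk-alternates {suc n} a walk x₀ (suc i) =
    alternating-step (walk i) (walk-alternates (a ∘ inject₁) (walk ∘ inject₁) x₀ i)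

  walk-ends-in-X : ∀ {n} (a : Fin (suc n) → V G) → IsWalk G a → InX G (a zero) →
    Even n → InX G (a (fromℕ n))
  walk-ends-in-X {n} a walk x₀ even
    with subst (Alternating (a (fromℕ n))) (toℕ-fromℕ n) (walk-alternates a walk x₀ (fromℕ n))
  ... | inj₁ (x , _) = x
  ... | inj₂ (_ , odd) = ⊥-elim (even-odd-disjoint n even odd)

  module _ (c₁ : Fin p) (c₂ : Fin q) where

    partner : V G → V G
    partner (inj₁ _) = inj₂ c₂
    partner (inj₂ _) = inj₁ c₁

    -- A hypothesis "c₁ is R-related to C_Y and c₂ to C_X" says that every
    -- vertex of a and b is R-related from its partner, since a and b alternate.
    partners-along : ∀ {n} (R : V G → V G → Set) (a b : Fin (suc n) → V G) →
      Congruent G a b → InX G (a zero) →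
      (∀ v → InCY G a b v → R (inj₁ c₁) v) → (∀ v → InCX G a b v → R (inj₂ c₂) v) →
      ∀ i → R (partner (a i)) (a i) × R (partner (b i)) (b i)
    partners-along R a b (walkA , walkB , sp , _) x₀ onCY onCX i =
      related (walk-alternates a walkA x₀ i) (inj₁ refl) ,
      related (walk-alternates b walkB (SamePart-X sp x₀) i) (inj₂ refl)
      where
      related : ∀ {w} → Alternating w (toℕ i) → (w ≡ a i ⊎ w ≡ b i) → R (partner w) w
      related {inj₁ _} (inj₁ (_ , even)) on = onCX _ (i , even , on)
      related {inj₂ _} (inj₂ (_ , odd)) on = onCY _ (i , odd , on)
      related {inj₁ _} (inj₂ (() , _)) _
      related {inj₂ _} (inj₁ (() , _)) _

    shadow : V G → V G
    shadow (inj₁ _) = inj₁ c₁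
    shadow (inj₂ _) = inj₂ c₂

    shadow-X : ∀ {w} → InX G w → shadow w ≡ inj₁ c₁
    shadow-X {inj₁ _} _ = refl

    -- An edge whose ends are not adjacent to their partners is independent
    -- from its shadow c₁c₂: the cross pairs are exactly partner pairs.
    shadow-step : T (E c₁ c₂) → ∀ {u v} → Adj G u v →
      ¬ Adj G (partner u) u → ¬ Adj G (partner v) v → Independent G u v (shadow u) (shadow v)
    shadow-step c₁c₂ {inj₁ _} {inj₂ _} uv ¬u ¬v = independent-if-no-cross (inj₁ (tt , tt)) uv c₁c₂ ¬u ¬v
    shadow-step c₁c₂ {inj₂ _} {inj₁ _} uv ¬u ¬v = independent-if-no-cross (inj₂ (tt , tt)) uv c₁c₂ ¬u ¬v
    shadow-step _ {inj₁ _} {inj₁ _} ()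
    shadow-step _ {inj₂ _} {inj₂ _} ()

    Γ-shadow : ∀ {n} (a : Fin (suc n) → V G) → IsWalk G a → InX G (a zero) → Even n →
      T (E c₁ c₂) → (∀ i → ¬ Adj G (partner (a i)) (a i)) →
      Γ G (a zero) (inj₁ c₁) (a (fromℕ n)) (inj₁ c₁)
    Γ-shadow {n} a walk x₀ even c₁c₂ apart =
      inj₁ (x₀ , tt) , n , a , shadow ∘ a ,
      congruent-from-steps a (shadow ∘ a) start
        (λ i → shadow-step c₁c₂ (walk i) (apart (inject₁ i)) (apart (suc i))) ,
      refl , refl , shadow-X x₀ , shadow-X (walk-ends-in-X a walk x₀ even)
      where
      start : SamePart G (a zero) (shadow (a zero))
      start = subst (SamePart G (a zero)) (sym (shadow-X x₀)) (inj₁ (x₀ , tt))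

    keepX : V G → V G
    keepX (inj₁ x) = inj₁ x
    keepX (inj₂ _) = inj₂ c₂

    keepY : V G → V G
    keepY (inj₁ _) = inj₁ c₁
    keepY (inj₂ y) = inj₂ y

    keepX-X : ∀ {w} → InX G w → keepX w ≡ w
    keepX-X {inj₁ _} _ = refl

    keepY-X : ∀ {w} → InX G w → keepY w ≡ inj₁ c₁
    keepY-X {inj₁ _} _ = refl

    -- If uv, u'v' are independent, c₁c₂ is a non-edge and all four ends are
    -- adjacent to their partners, then the edges keepX(uv), keepY(u'v') are
    -- independent: their cross pairs are c₁c₂ and a cross pair of uv, u'v'.
    interleave-step : ¬ T (E c₁ c₂) → ∀ {u v u' v'} → Independent G u v u' v' →
      Adj G (partner u) u → Adj G (partner v) v → Adj G (partner u') u' → Adj G (partner v') v' →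
      Independent G (keepX u) (keepX v) (keepY u') (keepY v')
    interleave-step ¬c₁c₂ {inj₁ x} {inj₂ _} {inj₁ _} {inj₂ y'} (_ , _ , _ , _ , _ , ¬uv' , _) pu _ _ pv' =
      independent-if-no-cross {inj₁ x} {inj₂ c₂} {inj₁ c₁} {inj₂ y'} (inj₁ (tt , tt)) pu pv' ¬uv' ¬c₁c₂
    interleave-step ¬c₁c₂ {inj₂ _} {inj₁ x} {inj₂ y'} {inj₁ _} (_ , _ , _ , _ , _ , _ , ¬u'v) _ pv pu' _ =
      independent-if-no-cross {inj₂ c₂} {inj₁ x} {inj₂ y'} {inj₁ c₁} (inj₂ (tt , tt)) pv pu' ¬c₁c₂ ¬u'v
    interleave-step _ {inj₁ x} {inj₂ _} {inj₂ y'} (sp , _) = ⊥-elim (different-parts {x} {y'} sp)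
    interleave-step _ {inj₂ y} {inj₁ _} {inj₁ x'} (sp , _) =
      ⊥-elim (different-parts {x'} {y} (SamePart-sym {inj₂ y} {inj₁ x'} sp))
    interleave-step _ {inj₁ _} {inj₂ _} {inj₁ _} {inj₁ _} (_ , _ , () , _)
    interleave-step _ {inj₂ _} {inj₁ _} {inj₂ _} {inj₂ _} (_ , _ , () , _)
    interleave-step _ {inj₁ _} {inj₁ _} (_ , () , _)
    interleave-step _ {inj₂ _} {inj₂ _} (_ , () , _)

    Γ-interleave : ∀ {n} (a b : Fin (suc n) → V G) → Congruent G a b → InX G (a zero) → Even n →
      ¬ T (E c₁ c₂) → (∀ i → Adj G (partner (a i)) (a i)) → (∀ i → Adj G (partner (b i)) (b i)) →
      Γ G (a zero) (inj₁ c₁) (a (fromℕ n)) (inj₁ c₁)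
    Γ-interleave {n} a b (walkA , walkB , sp , steps) x₀ even ¬c₁c₂ pa pb =
      inj₁ (x₀ , tt) , n , keepX ∘ a , keepY ∘ b ,
      congruent-from-steps (keepX ∘ a) (keepY ∘ b) start
        (λ i → interleave-step ¬c₁c₂ (steps i) (pa (inject₁ i)) (pa (suc i)) (pb (inject₁ i)) (pb (suc i))) ,
      keepX-X x₀ , keepX-X (walk-ends-in-X a walkA x₀ even) ,
      keepY-X y₀ , keepY-X (walk-ends-in-X b walkB y₀ even)
      where
      y₀ : InX G (b zero)
      y₀ = SamePart-X sp x₀
      start : SamePart G (keepX (a zero)) (keepY (b zero))
      start = subst₂ (SamePart G) (sym (keepX-X x₀)) (sym (keepY-X y₀)) (inj₁ (x₀ , tt))

proposition3p1 : (G : BipGraph) → (n : ℕ) → Odd (suc n) →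
    (a b : Fin (suc n) → V G) → Congruent G a b → InX G (a zero) →
    (c₁ : Fin (BipGraph.p G)) → (c₂ : Fin (BipGraph.q G)) →
    ((T (BipGraph.E G c₁ c₂) ×
       (∀ v → InCY G a b v → ¬ Adj G (inj₁ c₁) v) ×
       (∀ v → InCX G a b v → ¬ Adj G (inj₂ c₂) v))
     ⊎
     (¬ T (BipGraph.E G c₁ c₂) ×
       (∀ v → InCY G a b v → Adj G (inj₁ c₁) v) ×
       (∀ v → InCX G a b v → Adj G (inj₂ c₂) v))) →
    Γ G (a zero) (inj₁ c₁) (a (fromℕ n)) (inj₁ c₁) ×
    Γ G (inj₁ c₁) (b zero) (inj₁ c₁) (b (fromℕ n))
proposition3p1 G n odd a b ab@(walkA , walkB , sp , _) x₀ c₁ c₂ (inj₁ (c₁c₂ , onCY , onCX)) =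
  Γ-shadow G c₁ c₂ a walkA x₀ even c₁c₂ (proj₁ ∘ apart) ,
  Γ-sym G (Γ-shadow G c₁ c₂ b walkB (SamePart-X G sp x₀) even c₁c₂ (proj₂ ∘ apart))
  where
  even : Even n
  even = even-pred odd
  apart : ∀ i → ¬ Adj G (partner G c₁ c₂ (a i)) (a i) × ¬ Adj G (partner G c₁ c₂ (b i)) (b i)
  apart = partners-along G c₁ c₂ (λ u v → ¬ Adj G u v) a b ab x₀ onCY onCX
proposition3p1 G n odd a b ab@(_ , _ , sp , _) x₀ c₁ c₂ (inj₂ (¬c₁c₂ , onCY , onCX)) =
  Γ-interleave G c₁ c₂ a b ab x₀ even ¬c₁c₂ (proj₁ ∘ adjacent) (proj₂ ∘ adjacent) ,
  Γ-sym G (Γ-interleave G c₁ c₂ b a (Congruent-sym G {a = a} {b = b} ab) (SamePart-X G sp x₀) even ¬c₁c₂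
             (proj₂ ∘ adjacent) (proj₁ ∘ adjacent))
  where
  even : Even n
  even = even-pred odd
  adjacent : ∀ i → Adj G (partner G c₁ c₂ (a i)) (a i) × Adj G (partner G c₁ c₂ (b i)) (b i)
  adjacent = partners-along G c₁ c₂ (Adj G) a b ab x₀ onCY onCX
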